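{- A graph $P$ satisfies $\mathrm{cov}_{A'B'}(P)=2$ if and only if $P$ is disconnected.
   Context: All graphs are finite and simple. Distances are in $P$ ($\infty$ if no path); for a vertex $p$ and vertex sets $S,T$, $d(p,S)=d(S,p)=\min_{s\in S}d(p,s)$ and $d(S,T)=\min_{s\in S,t\in T}d(s,t)$. A covering of $P$ is a family $\{P_1,\dots,P_k\}$ of subsets of $V(P)$ with $\bigcup P_i=V(P)$; $k$ is its size. Condition A$'$: for each $i$, either there is $p\notin P_i$ with $d(P_i,p)\geq 3$, or there is $j\neq i$ with $d(P_i,P_j)\geq 2$. Condition B$'$: for each $i$ and each $p\in P_i$ there is $j\neq i$ with $d(p,P_j)\geq 2$. $\mathrm{cov}_{A'B'}(P)$ is the smallest size of a covering of $P$ satisfying both conditions A$'$ and B$'$. -}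

module Defs where

open import Data.Nat using (ℕ; zero; suc; _<_)
open import Data.Fin using (Fin)
open import Data.Fin.Subset using (Subset; _∈_; _∉_; Nonempty)
open import Data.Product using (Σ; ∃; _×_)
open import Data.Sum using (_⊎_)
open import Relation.Nullary using (¬_; Dec)
open import Relation.Binary.PropositionalEquality using (_≡_)
open import Level using (0ℓ; suc)

record Graph (n : ℕ) : Set₁ where
  field
    Adj    : Fin n → Fin n → Set
    sym    : ∀ {u v} → Adj u v → Adj v u
    irrefl : ∀ {u} → ¬ Adj u u
    adj?   : ∀ u v → Dec (Adj u v)
open Graph public

module _ {n : ℕ} (G : Graph n) where

  data Walk : Fin n → Fin n → ℕ → Set where
    here : ∀ {u} → Walk u u zero
    step : ∀ {u w v k} → Adj G u w → Walk w v k → Walk u v (ℕ.suc k)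

  -- d(u,v) ≥ k  (d is shortest-path distance, ∞ if no path)
  DistGE : Fin n → Fin n → ℕ → Set
  DistGE u v k = ∀ m → m < k → ¬ Walk u v m

  DistSetPtGE : Subset n → Fin n → ℕ → Set
  DistSetPtGE S p k = ∀ s → s ∈ S → DistGE s p k

  DistSetSetGE : Subset n → Subset n → ℕ → Set
  DistSetSetGE S T k = ∀ s t → s ∈ S → t ∈ T → DistGE s t k

  IsCovering : (k : ℕ) → (Fin k → Subset n) → Set
  IsCovering k P = (∀ i → Nonempty (P i)) × (∀ v → ∃ λ i → v ∈ P i)

  CondA' : (k : ℕ) → (Fin k → Subset n) → Set
  CondA' k P = ∀ i →
      (∃ λ p → p ∉ P i × DistSetPtGE (P i) p 3)
    ⊎ (∃ λ j → ¬ (j ≡ i) × DistSetSetGE (P i) (P j) 2)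

  CondB' : (k : ℕ) → (Fin k → Subset n) → Set
  CondB' k P = ∀ i p → p ∈ P i → ∃ λ j → ¬ (j ≡ i) × DistSetPtGE (P j) p 2

  HasA'B'Covering : ℕ → Set
  HasA'B'Covering k = ∃ λ (P : Fin k → Subset n) → IsCovering k P × CondA' k P × CondB' k P

  CovA'B'≡ : ℕ → Set
  CovA'B'≡ k = HasA'B'Covering k × (∀ m → m < k → ¬ HasA'B'Covering m)

  Connected : Set
  Connected = ∀ u v → ∃ λ k → Walk u v k

  Disconnected : Set
  Disconnected = ∃ λ u → ∃ λ v → ∀ k → ¬ Walk u v k

-- A covering satisfying B′ by two sets P₀, P₁ forces P₀ to be closed under
-- adjacency: a neighbour of x ∈ P₀ lies at distance 1 from x, so it avoids P₁,
-- which B′ keeps at distance ≥ 2 from x.  Hence no walk leaves P₀, and P₁ is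
-- unreachable from it.  Conversely, a disconnected graph has a closed set C (the
-- component of a vertex) with nonempty complement; {C, ∁ C} satisfies A′ and B′
-- because there is no walk between C and ∁ C at all.  Minimality is immediate:
-- a covering of size 1 violates A′, and one of size 0 covers no vertex.
module Submission where

open import Defs
open import Data.Nat using (ℕ; zero; suc; _<_; _≤_; _+_; s≤s; z≤n)
open import Data.Nat.Properties
  using (m≤m+n; +-monoʳ-<; ≤-trans; <-≤-trans; <⇒≱)
open import Data.Fin using (Fin)
open import Data.Fin.Patterns using (0F; 1F)
open import Data.Fin.Properties using (any?)
open import Data.Fin.Subset using (Subset; _∈_; _∉_; ⁅_⁆; _∪_; ∁; ∣_∣; Nonempty)
open import Data.Fin.Subset.Properties
  using (_∈?_; ∣p∣≤n; x∈⁅x⁆; x∈⁅y⁆⇒x≡y; p⊆p∪q; x∈p∪q⁺; x∈p∪q⁻;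
         p⊂q⇒∣p∣<∣q∣; x∈p⇒x∉∁p; x∈∁p⇒x∉p; x∉p⇒x∈∁p)
open import Data.Product using (∃; ∃₂; _×_; _,_)
open import Data.Sum using (_⊎_; inj₁; inj₂)
open import Data.Empty using (⊥-elim)
open import Relation.Nullary using (¬_; yes; no; ¬?; contradiction)
open import Relation.Nullary.Decidable using (_×-dec_)
open import Relation.Binary.PropositionalEquality using (refl)

module _ {n : ℕ} (G : Graph n) where

  Reachable : Fin n → Fin n → Set
  Reachable u v = ∃ λ k → Walk G u v k

  Closed : Subset n → Set
  Closed C = ∀ {x y} → x ∈ C → Adj G x y → y ∈ C

  walk-snoc : ∀ {u x y k} → Walk G u x k → Adj G x y → Walk G u y (suc k)
  walk-snoc here       x~y = step x~y here
  walk-snoc (step a w)  x~y = step a (walk-snoc w x~y)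

  reachable-snoc : ∀ {u x y} → Reachable u x → Adj G x y → Reachable u y
  reachable-snoc (k , w) x~y = suc k , walk-snoc w x~y

  walk-closed : ∀ {C s t k} → Closed C → s ∈ C → Walk G s t k → t ∈ C
  walk-closed cl s∈C here       = s∈C
  walk-closed cl s∈C (step a w) = walk-closed cl (cl s∈C a) w

  closed⇒far : ∀ {C t} k → Closed C → t ∉ C → DistSetPtGE G C t k
  closed⇒far k cl t∉C s s∈C m _ w = t∉C (walk-closed cl s∈C w)

  closed-∁ : ∀ {C} → Closed C → Closed (∁ C)
  closed-∁ {C} cl {x} {y} x∈∁C x~y with y ∈? C
  ... | yes y∈C = contradiction (cl y∈C (Graph.sym G x~y)) (x∈∁p⇒x∉p x∈∁C)
  ... | no  y∉C = x∉p⇒x∈∁p y∉C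

  x∉p⇒∣p∣<∣p∪⁅x⁆∣ : ∀ {p : Subset n} {x} → x ∉ p → ∣ p ∣ < ∣ p ∪ ⁅ x ⁆ ∣
  x∉p⇒∣p∣<∣p∪⁅x⁆∣ {x = x} x∉p = p⊂q⇒∣p∣<∣q∣ (p⊆p∪q ⁅ x ⁆ , x , x∈p∪q⁺ (inj₂ (x∈⁅x⁆ x)) , x∉p)

  closed-or-exit : ∀ S → Closed S ⊎ ∃₂ λ x y → x ∈ S × Adj G x y × y ∉ S
  closed-or-exit S
    with any? (λ x → any? λ y → (x ∈? S) ×-dec (adj? G x y ×-dec ¬? (y ∈? S)))
  ... | yes (x , y , x∈S , x~y , y∉S) = inj₂ (x , y , x∈S , x~y , y∉S)
  ... | no  ¬exit = inj₁ closed
    where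
    closed : Closed S
    closed {x} {y} x∈S x~y with y ∈? S
    ... | yes y∈S = y∈S
    ... | no  y∉S = ⊥-elim (¬exit (x , y , x∈S , x~y , y∉S))

  -- Each step adds a vertex, so the invariant n ≤ fuel + ∣ S ∣ keeps the fuel
  -- from running out before S is closed.
  saturate : ∀ {u} (fuel : ℕ) (S : Subset n) → u ∈ S → (∀ {x} → x ∈ S → Reachable u x) →
             n ≤ fuel + ∣ S ∣ → ∃ λ C → Closed C × u ∈ C × (∀ {x} → x ∈ C → Reachable u x)
  saturate {u} fuel S u∈S reach n≤ with closed-or-exit S
  ... | inj₁ cl = S , cl , u∈S , reach
  ... | inj₂ (x , y , x∈S , x~y , y∉S) with fuel
  ...   | zero   = ⊥-elim (<⇒≱ (<-≤-trans (x∉p⇒∣p∣<∣p∪⁅x⁆∣ y∉S) (∣p∣≤n (S ∪ ⁅ y ⁆))) n≤)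
  ...   | suc f  = saturate f S′ (p⊆p∪q ⁅ y ⁆ u∈S) reach′ n≤′
    where
    S′ = S ∪ ⁅ y ⁆
    reach′ : ∀ {z} → z ∈ S′ → Reachable u z
    reach′ z∈S′ with x∈p∪q⁻ S ⁅ y ⁆ z∈S′
    ... | inj₁ z∈S = reach z∈S
    ... | inj₂ z∈y with x∈⁅y⁆⇒x≡y y z∈y
    ...   | refl = reachable-snoc (reach x∈S) x~y
    n≤′ : n ≤ f + ∣ S′ ∣
    n≤′ = ≤-trans n≤ (+-monoʳ-< f (x∉p⇒∣p∣<∣p∪⁅x⁆∣ y∉S))

  component : ∀ u → ∃ λ C → Closed C × u ∈ C × (∀ {x} → x ∈ C → Reachable u x)
  component u = saturate n ⁅ u ⁆ (x∈⁅x⁆ u) reach (m≤m+n n ∣ ⁅ u ⁆ ∣)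
    where
    reach : ∀ {x} → x ∈ ⁅ u ⁆ → Reachable u x
    reach x∈u with x∈⁅y⁆⇒x≡y u x∈u
    ... | refl = 0 , here

  far⇒∉ : ∀ {S p k} → DistSetPtGE G S p (suc k) → p ∉ S
  far⇒∉ far p∈S = far _ p∈S 0 (s≤s z≤n) here

  B′₂⇒closed : (P : Fin 2 → Subset n) → (∀ v → ∃ λ i → v ∈ P i) → CondB' G 2 P →
               Closed (P 0F)
  B′₂⇒closed P cover B {x} {y} x∈P₀ x~y with B 0F x x∈P₀ | cover y
  ... | 0F , 0≢0 , _ | _ = contradiction refl 0≢0
  ... | 1F , _ , _   | 0F , y∈P₀ = y∈P₀
  ... | 1F , _ , far | 1F , y∈P₁ =
    contradiction (step (Graph.sym G x~y) here) (far y y∈P₁ 1 (s≤s (s≤s z≤n)))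

  covering₂⇒disconnected : HasA'B'Covering G 2 → Disconnected G
  covering₂⇒disconnected (P , (nonempty , cover) , _ , B)
    with nonempty 0F | nonempty 1F
  ... | u , u∈P₀ | v , v∈P₁ =
    u , v , λ k w → v∉P₀ (walk-closed (B′₂⇒closed P cover B) u∈P₀ w)
    where
    v∉P₀ : v ∉ P 0F
    v∉P₀ with B 1F v v∈P₁
    ... | 0F , _ , far = far⇒∉ far
    ... | 1F , 1≢1 , _ = contradiction refl 1≢1

  closed⇒covering₂ : ∀ {C u v} → Closed C → u ∈ C → v ∉ C → HasA'B'Covering G 2
  closed⇒covering₂ {C} {u} {v} cl u∈C v∉C = P , (nonempty , cover) , A , B
    where
    P : Fin 2 → Subset n
    P 0F = C
    P 1F = ∁ C
    nonempty : ∀ i → Nonempty (P i)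
    nonempty 0F = u , u∈C
    nonempty 1F = v , x∉p⇒x∈∁p v∉C
    cover : ∀ x → ∃ λ i → x ∈ P i
    cover x with x ∈? C
    ... | yes x∈C = 0F , x∈C
    ... | no  x∉C = 1F , x∉p⇒x∈∁p x∉C
    A : CondA' G 2 P
    A 0F = inj₂ (1F , (λ ()) ,
      λ s t s∈C t∈∁C → closed⇒far 2 cl (x∈∁p⇒x∉p t∈∁C) s s∈C)
    A 1F = inj₂ (0F , (λ ()) ,
      λ s t s∈∁C t∈C → closed⇒far 2 (closed-∁ cl) (x∈p⇒x∉∁p t∈C) s s∈∁C)
    B : CondB' G 2 P
    B 0F p p∈C  = 1F , (λ ()) , closed⇒far 2 (closed-∁ cl) (x∈p⇒x∉∁p p∈C)
    B 1F p p∈∁C = 0F , (λ ()) , closed⇒far 2 cl (x∈∁p⇒x∉p p∈∁C)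

  no-covering₀ : Fin n → ¬ HasA'B'Covering G 0
  no-covering₀ u (_ , (_ , cover) , _) with cover u
  ... | () , _

  no-A′-covering₁ : ¬ HasA'B'Covering G 1
  no-A′-covering₁ (P , (_ , cover) , A , _) with A 0F
  ... | inj₂ (0F , 0≢0 , _) = contradiction refl 0≢0
  ... | inj₁ (p , p∉P₀ , _) with cover p
  ...   | 0F , p∈P₀ = p∉P₀ p∈P₀

  disconnected⇒cov₂ : Disconnected G → CovA'B'≡ G 2
  disconnected⇒cov₂ (u , v , unreachable) with component u
  ... | C , cl , u∈C , reach = closed⇒covering₂ cl u∈C v∉C , minimal
    where
    v∉C : v ∉ C
    v∉C v∈C = let (k , w) = reach v∈C in unreachable k w
    minimal : ∀ m → m < 2 → ¬ HasA'B'Covering G m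
    minimal zero          _ = no-covering₀ u
    minimal (suc zero)    _ = no-A′-covering₁
    minimal (suc (suc _)) (s≤s (s≤s ()))

proposition5p5 : (n : ℕ) (G : Graph n) →
    (CovA'B'≡ G 2 → Disconnected G) × (Disconnected G → CovA'B'≡ G 2)
proposition5p5 n G = (λ (covering , _) → covering₂⇒disconnected G covering) , disconnected⇒cov₂ G
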